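{- There exist recursively enumerable sets $A, B\subseteq\Sigma^*$ such that $A$ is $\mathrm{F}_{\mathrm{REC}}$-compressible to $B$ and $B$ is $\mathrm{F}_{\mathrm{REC}}$-compressible to $A$, yet $A$ and $B$ are not recursively isomorphic.
   Context: $\Sigma=\{0,1\}$. $A$ and $B$ are recursively isomorphic if there is a total recursive bijection $f:\Sigma^*\to\Sigma^*$ with $f(A)=B$. $\mathrm{F}_{\mathrm{REC}}$ is the class of total recursive functions from $\Sigma^*$ to $\Sigma^*$. Given $A,B\subseteq\Sigma^*$, a function $f$ is a compression function for $A$ to $B$ if $\mathrm{domain}(f)\supseteq A$, $f(A)=B$, and $f$ is injective on $A$; $A$ is $\mathrm{F}_{\mathrm{REC}}$-compressible to $B$ if some $f\in\mathrm{F}_{\mathrm{REC}}$ is a compression function for $A$ to $B$. -}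

module Defs where

open import Data.Nat using (ℕ; zero; suc; _+_; _*_; _<_)
open import Data.Bool using (Bool; true; false)
open import Data.List using (List; []; _∷_)
open import Data.Vec using (Vec; []; _∷_; lookup)
open import Data.Fin using (Fin)
open import Data.Product using (Σ; ∃; _×_; _,_)
open import Function.Definitions using (Injective; Surjective)
open import Relation.Binary.PropositionalEquality using (_≡_)

-- Σ = {0,1}; Σ* is rendered as List Bool (false = 0, true = 1).
Word : Set
Word = List Bool

Lang : Set₁
Lang = Word → Set

data PR : ℕ → Set where
  zer  : ∀ {k} → PR k
  succ : PR 1
  proj : ∀ {k} → Fin k → PR k
  comp : ∀ {k m} → PR m → Vec (PR k) m → PR k
  prec : ∀ {k} → PR k → PR (suc (suc k)) → PR (suc k)
  mu   : ∀ {k} → PR (suc k) → PR k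

mutual
  data _⟦_⟧⇓_ : ∀ {k} → PR k → Vec ℕ k → ℕ → Set where
    ev-zer  : ∀ {k} {xs : Vec ℕ k} → zer ⟦ xs ⟧⇓ 0
    ev-succ : ∀ {n} → succ ⟦ n ∷ [] ⟧⇓ suc n
    ev-proj : ∀ {k} {i : Fin k} {xs} → proj i ⟦ xs ⟧⇓ lookup xs i
    ev-comp : ∀ {k m} {f : PR m} {gs : Vec (PR k) m} {xs ys v} →
              gs ⟦ xs ⟧⇓* ys → f ⟦ ys ⟧⇓ v → comp f gs ⟦ xs ⟧⇓ v
    ev-prec-z : ∀ {k} {f : PR k} {g : PR (suc (suc k))} {xs v} →
              f ⟦ xs ⟧⇓ v → prec f g ⟦ 0 ∷ xs ⟧⇓ v
    ev-prec-s : ∀ {k} {f : PR k} {g : PR (suc (suc k))} {n xs u v} →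
              prec f g ⟦ n ∷ xs ⟧⇓ u → g ⟦ n ∷ u ∷ xs ⟧⇓ v →
              prec f g ⟦ suc n ∷ xs ⟧⇓ v
    ev-mu   : ∀ {k} {f : PR (suc k)} {xs n} →
              f ⟦ n ∷ xs ⟧⇓ 0 →
              (∀ m → m < n → ∃ λ v → f ⟦ m ∷ xs ⟧⇓ suc v) →
              mu f ⟦ xs ⟧⇓ n

  data _⟦_⟧⇓*_ : ∀ {k m} → Vec (PR k) m → Vec ℕ k → Vec ℕ m → Set where
    ev-[] : ∀ {k} {xs : Vec ℕ k} → [] ⟦ xs ⟧⇓* []
    ev-∷  : ∀ {k m} {g : PR k} {gs : Vec (PR k) m} {xs v vs} →
            g ⟦ xs ⟧⇓ v → gs ⟦ xs ⟧⇓* vs → (g ∷ gs) ⟦ xs ⟧⇓* (v ∷ vs)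

-- Standard (bijective base-2) encoding of Σ* into ℕ:
-- ε ↦ 0, w·b ... concretely  code (b ∷ w) = 1 + b + 2 * code w.

code : Word → ℕ
code []          = 0
code (false ∷ w) = 1 + 2 * code w
code (true ∷ w)  = 2 + 2 * code w

TotalRecursive : (Word → Word) → Set
TotalRecursive f = Σ (PR 1) λ e → ∀ w → e ⟦ code w ∷ [] ⟧⇓ code (f w)

RecEnum : Lang → Set
RecEnum A = Σ (PR 1) λ e → ∀ w → (A w → ∃ λ v → e ⟦ code w ∷ [] ⟧⇓ v)
                                × ((∃ λ v → e ⟦ code w ∷ [] ⟧⇓ v) → A w)

ImageEq : (Word → Word) → Lang → Lang → Set
ImageEq f A B = (∀ w → A w → B (f w)) × (∀ v → B v → ∃ λ w → A w × f w ≡ v)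

InjectiveOn : (Word → Word) → Lang → Set
InjectiveOn f A = ∀ x y → A x → A y → f x ≡ f y → x ≡ y

-- f is a compression function for A to B (f total, so domain(f) ⊇ A holds).
CompressionFunction : (Word → Word) → Lang → Lang → Set
CompressionFunction f A B = ImageEq f A B × InjectiveOn f A

FRECCompressible : Lang → Lang → Set
FRECCompressible A B = Σ (Word → Word) λ f → TotalRecursive f × CompressionFunction f A B

RecIsomorphic : Lang → Lang → Set
RecIsomorphic A B = Σ (Word → Word) λ f →
  TotalRecursive f × Injective _≡_ _≡_ f × Surjective _≡_ _≡_ f × ImageEq f A B

-- Take A = Σ* and B = Σ* ∖ {ε}.  Under the bijective base-2 numbering `code`,
-- successor and predecessor on words are total recursive and are mutually
-- inverse bijections between A and B, so each set compresses to the other.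
-- A recursive isomorphism, however, is a surjection of Σ* mapping every word
-- into B, so it would have to hit ε ∉ B.
module Submission where

open import Defs
open import Data.Bool using (true; false)
open import Data.Empty using (⊥-elim)
open import Data.Fin using (zero; suc)
open import Data.List using ([]; _∷_)
open import Data.Nat using (ℕ; zero; suc; pred; _+_; _*_)
open import Data.Nat.Properties using (*-suc)
open import Data.Product using (Σ; ∃; _×_; _,_)
open import Data.Unit using (⊤; tt)
open import Data.Vec using ([]; _∷_)
open import Relation.Binary.PropositionalEquality
open import Relation.Nullary using (¬_)

Σ* : Lang
Σ* _ = ⊤

Σ⁺ : Lang
Σ⁺ w = w ≢ []

succʷ : Word → Word
succʷ []          = false ∷ []
succʷ (false ∷ w) = true ∷ w
succʷ (true ∷ w)  = false ∷ succʷ w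

predʷ : Word → Word
predʷ []              = []
predʷ (true ∷ w)      = false ∷ w
predʷ (false ∷ [])    = []
predʷ (false ∷ b ∷ w) = true ∷ predʷ (b ∷ w)

succʷ≢[] : ∀ w → succʷ w ≢ []
succʷ≢[] []          ()
succʷ≢[] (false ∷ w) ()
succʷ≢[] (true ∷ w)  ()

predʷ-succʷ : ∀ w → predʷ (succʷ w) ≡ w
predʷ-succʷ []          = refl
predʷ-succʷ (false ∷ w) = refl
predʷ-succʷ (true ∷ w) with succʷ w | succʷ≢[] w | predʷ-succʷ w
... | []    | succw≢[] | _  = ⊥-elim (succw≢[] refl)
... | _ ∷ _ | _        | eq = cong (true ∷_) eq

succʷ-predʷ : ∀ w → w ≢ [] → succʷ (predʷ w) ≡ w
succʷ-predʷ []              w≢[] = ⊥-elim (w≢[] refl)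
succʷ-predʷ (true ∷ w)      _    = refl
succʷ-predʷ (false ∷ [])    _    = refl
succʷ-predʷ (false ∷ b ∷ w) _    = cong (false ∷_) (succʷ-predʷ (b ∷ w) λ ())

code-succʷ : ∀ w → code (succʷ w) ≡ suc (code w)
code-succʷ []          = refl
code-succʷ (false ∷ w) = refl
code-succʷ (true ∷ w)  = cong suc (begin
  2 * code (succʷ w)  ≡⟨ cong (2 *_) (code-succʷ w) ⟩
  2 * suc (code w)    ≡⟨ *-suc 2 (code w) ⟩
  2 + 2 * code w      ∎)
  where open ≡-Reasoning

code-predʷ : ∀ w → code (predʷ w) ≡ pred (code w)
code-predʷ []      = refl
code-predʷ (b ∷ w) = begin
  code (predʷ (b ∷ w))                 ≡⟨ cong pred (code-succʷ (predʷ (b ∷ w))) ⟨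
  pred (code (succʷ (predʷ (b ∷ w))))  ≡⟨ cong (λ v → pred (code v)) (succʷ-predʷ (b ∷ w) λ ()) ⟩
  pred (code (b ∷ w))                  ∎
  where open ≡-Reasoning

code≡0⇒[] : ∀ w → code w ≡ 0 → w ≡ []
code≡0⇒[] []          _ = refl
code≡0⇒[] (false ∷ w) ()
code≡0⇒[] (true ∷ w)  ()

totalRecursive-viaCode : ∀ (f : Word → Word) (e : PR 1) (g : ℕ → ℕ) →
  (∀ n → e ⟦ n ∷ [] ⟧⇓ g n) → (∀ w → code (f w) ≡ g (code w)) → TotalRecursive f
totalRecursive-viaCode f e g e-computes-g f≈g =
  e , λ w → subst (e ⟦ code w ∷ [] ⟧⇓_) (sym (f≈g w)) (e-computes-g (code w))

predᴾ : PR 1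
predᴾ = prec zer (proj zero)

predᴾ-computes : ∀ n → predᴾ ⟦ n ∷ [] ⟧⇓ pred n
predᴾ-computes zero    = ev-prec-z ev-zer
predᴾ-computes (suc n) = ev-prec-s (predᴾ-computes n) ev-proj

isZero : ℕ → ℕ
isZero zero    = 1
isZero (suc _) = 0

isZeroᴾ : PR 1
isZeroᴾ = prec (comp succ (zer ∷ [])) zer

isZeroᴾ-computes : ∀ n → isZeroᴾ ⟦ n ∷ [] ⟧⇓ isZero n
isZeroᴾ-computes zero    = ev-prec-z (ev-comp (ev-∷ ev-zer ev-[]) ev-succ)
isZeroᴾ-computes (suc n) = ev-prec-s (isZeroᴾ-computes n) ev-zer

isZeroᴾ-at-0 : ∀ {v} → isZeroᴾ ⟦ 0 ∷ [] ⟧⇓ v → v ≡ 1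
isZeroᴾ-at-0 (ev-prec-z (ev-comp (ev-∷ ev-zer ev-[]) ev-succ)) = refl

-- The μ-body ignores the counter, so the search halts (at 0) iff the input is nonzero.
nonzeroᴾ : PR 1
nonzeroᴾ = mu (comp isZeroᴾ (proj (suc zero) ∷ []))

nonzeroᴾ-halts : ∀ n → n ≢ 0 → ∃ λ v → nonzeroᴾ ⟦ n ∷ [] ⟧⇓ v
nonzeroᴾ-halts zero    n≢0 = ⊥-elim (n≢0 refl)
nonzeroᴾ-halts (suc n) _   =
  0 , ev-mu (ev-comp (ev-∷ ev-proj ev-[]) (isZeroᴾ-computes (suc n))) λ _ ()

nonzeroᴾ-diverges-at-0 : ∀ {v} → ¬ nonzeroᴾ ⟦ 0 ∷ [] ⟧⇓ v
nonzeroᴾ-diverges-at-0 (ev-mu (ev-comp (ev-∷ ev-proj ev-[]) isZero≡0) _)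
  with isZeroᴾ-at-0 isZero≡0
... | ()

recEnum-Σ* : RecEnum Σ*
recEnum-Σ* = zer , λ _ → (λ _ → 0 , ev-zer) , λ _ → tt

recEnum-Σ⁺ : RecEnum Σ⁺
recEnum-Σ⁺ = nonzeroᴾ , λ w →
    (λ w≢[] → nonzeroᴾ-halts (code w) λ code≡0 → w≢[] (code≡0⇒[] w code≡0))
  , λ { (_ , halts) refl → nonzeroᴾ-diverges-at-0 halts }

compressionFunction-fromInverse : ∀ {A B : Lang} (f g : Word → Word) →
  (∀ w → A w → B (f w)) → (∀ v → B v → A (g v)) →
  (∀ w → A w → g (f w) ≡ w) → (∀ v → B v → f (g v) ≡ v) →
  CompressionFunction f A B
compressionFunction-fromInverse f g f-into g-into gf≡id fg≡id =
    (f-into , λ v Bv → g v , g-into v Bv , fg≡id v Bv)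
  , λ x y Ax Ay fx≡fy →
      trans (sym (gf≡id x Ax)) (trans (cong g fx≡fy) (gf≡id y Ay))

¬recIsomorphic-toProper : ∀ {A B : Lang} → (∀ w → A w) → (v : Word) → ¬ B v →
  ¬ RecIsomorphic A B
¬recIsomorphic-toProper allA v ¬Bv (f , _ , _ , surjective , into , _)
  with surjective v
... | w , fw≡v = ¬Bv (subst _ (fw≡v refl) (into w (allA w)))

theorem10 : Σ Lang λ A → Σ Lang λ B →
    RecEnum A × RecEnum B ×
    FRECCompressible A B × FRECCompressible B A ×
    ¬ RecIsomorphic A B
theorem10 = Σ* , Σ⁺ , recEnum-Σ* , recEnum-Σ⁺ , Σ*↠Σ⁺ , Σ⁺↠Σ* ,
            ¬recIsomorphic-toProper _ [] λ []≢[] → []≢[] refl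
  where
  Σ*↠Σ⁺ : FRECCompressible Σ* Σ⁺
  Σ*↠Σ⁺ = succʷ
    , totalRecursive-viaCode succʷ succ suc (λ _ → ev-succ) code-succʷ
    , compressionFunction-fromInverse succʷ predʷ
        (λ w _ → succʷ≢[] w) _ (λ w _ → predʷ-succʷ w) succʷ-predʷ

  Σ⁺↠Σ* : FRECCompressible Σ⁺ Σ*
  Σ⁺↠Σ* = predʷ
    , totalRecursive-viaCode predʷ predᴾ pred predᴾ-computes code-predʷ
    , compressionFunction-fromInverse predʷ succʷ
        _ (λ v _ → succʷ≢[] v) succʷ-predʷ (λ v _ → predʷ-succʷ v)
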